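{- The number of friezes of type $G_2$ is $9$.
   Context: A frieze of type $\Delta$ is a ring homomorphism from the coefficient-free cluster algebra of type $\Delta$ to $\mathbb{Z}$ sending every cluster variable to a positive integer (equivalently, positive integers $a(j,m)$ satisfying $a(j,m)a(j,m+1)=1+\prod_{j\to i}a(i,m)^{|C_{i,j}|}\prod_{i\to j}a(i,m+1)^{|C_{i,j}|}$ for the Cartan matrix $C$ of type $G_2$ and an acyclic orientation). Type $G_2$ is the folding of $D_4$ by the order-$3$ rotation of its Dynkin diagram. -}

module Defs where

open import Data.Bool using (Bool; true; false; if_then_else_)
open import Data.Fin using (Fin; zero; suc)
open import Data.Nat using (ℕ; _*_; _+_; _^_; _<_)
open import Data.Integer using (ℤ; +_; -[1+_]; ∣_∣) renaming (_+_ to _+ℤ_)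
open import Data.Product using (Σ; _×_)
open import Relation.Binary.PropositionalEquality using (_≡_)

C : Fin 2 → Fin 2 → ℤ
C zero zero = + 2
C zero (suc zero) = -[1+ 0 ]
C (suc zero) zero = -[1+ 2 ]
C (suc zero) (suc zero) = + 2

-- An acyclic orientation of the (unique) edge: arrow i j = true iff i → j.
-- We orient 0 → 1.
arrow : Fin 2 → Fin 2 → Bool
arrow zero (suc zero) = true
arrow _ _ = false

∏ : (Fin 2 → ℕ) → ℕ
∏ f = f zero * f (suc zero)

-- Right-hand side of the frieze relation at (j, m):
-- 1 + ∏_{j→i} a(i,m)^{|C i j|} ∏_{i→j} a(i,m+1)^{|C i j|}
rhs : (Fin 2 → ℤ → ℕ) → Fin 2 → ℤ → ℕ
rhs a j m =
  1 + ∏ (λ i → if arrow j i then a i m ^ ∣ C i j ∣ else 1)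
      * ∏ (λ i → if arrow i j then a i (m +ℤ + 1) ^ ∣ C i j ∣ else 1)

record Frieze : Set where
  field
    a        : Fin 2 → ℤ → ℕ
    positive : ∀ j m → 0 < a j m
    relation : ∀ j m → a j m * a j (m +ℤ + 1) ≡ rhs a j m
open Frieze public

_≈F_ : Frieze → Frieze → Set
F ≈F G = ∀ j m → a F j m ≡ a G j m

HasExactly : ℕ → Set
HasExactly n =
  Σ (Fin n → Frieze) λ f →
    (∀ i k → f i ≈F f k → i ≡ k) ×
    (∀ (F : Frieze) → Σ (Fin n) λ i → F ≈F f i)

-- Eliminating P from the frieze relations, any three consecutive vertex-1 values a, q, b
-- satisfy the exchange relation q a b = q² + a + b. So q divides a + b, say a + b = x q,
-- and then a b = q + x; these Vieta relations give (x − 1)(q − 1) + (a − 1)(b − 1) = 2,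
-- whence q ≤ 5. Two consecutive vertex-1 values determine the whole frieze, and a finite
-- search over windows in [1, 5]³ leaves exactly the windows of nine 4-periodic friezes:
-- at vertex 1 the rotations of 1 3 5 2 and of 1 2 5 3, and the constant 2.
module Submission where

open import Defs
open import Data.Fin using (Fin; zero; suc)
open import Data.Fin.Properties using (all?; any?) renaming (_≟_ to _≟ᶠ_)
open import Data.Integer using (ℤ; +_; -[1+_]) renaming (_+_ to _+ℤ_)
open import Data.Nat
open import Data.Nat.Properties
open import Data.Nat.Tactic.RingSolver using (solve-∀)
open import Data.Product using (Σ; ∃-syntax; _×_; _,_; proj₁; proj₂)
open import Data.Vec using (Vec; []; _∷_; lookup)
open import Relation.Nullary.Decidable using (from-yes; _×-dec_; _→-dec_)
open import Relation.Binary.PropositionalEquality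

+≤*+1 : ∀ m n → suc m + suc n ≤ suc m * suc n + 1
+≤*+1 m n = subst (suc m + suc n ≤_) (expand m n) (m≤m+n (suc m + suc n) (m * n))
  where
  expand : ∀ m n → suc m + suc n + m * n ≡ suc m * suc n + 1
  expand = solve-∀

*≡2⇒+≤3 : ∀ {m n} → m * n ≡ 2 → m + n ≤ 3
*≡2⇒+≤3 {suc m} {suc n} m*n≡2 = subst (suc m + suc n ≤_) (cong (_+ 1) m*n≡2) (+≤*+1 m n)
*≡2⇒+≤3 {suc m} {zero} m*n≡2 with () ← trans (sym (*-zeroʳ m)) m*n≡2

shifted-vieta : ∀ a b q x → suc a * suc b ≡ suc q + suc x → suc a + suc b ≡ suc x * suc q →
                x * q + a * b ≡ 2
shifted-vieta a b q x product sum = +-cancelˡ-≡ (a + b + q + x + 3) _ _ (begin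
  a + b + q + x + 3 + (x * q + a * b)  ≡⟨ expandˡ a b q x ⟩
  suc a * suc b + suc x * suc q + 1    ≡⟨ cong₂ (λ u v → u + v + 1) product (sym sum) ⟩
  suc q + suc x + (suc a + suc b) + 1  ≡⟨ expandʳ a b q x ⟩
  a + b + q + x + 3 + 2                ∎)
  where
  open ≡-Reasoning
  expandˡ : ∀ a b q x → a + b + q + x + 3 + (x * q + a * b) ≡ suc a * suc b + suc x * suc q + 1
  expandˡ = solve-∀
  expandʳ : ∀ a b q x → suc q + suc x + (suc a + suc b) + 1 ≡ a + b + q + x + 3 + 2
  expandʳ = solve-∀

vieta-bound : ∀ {a b q x} → 0 < a → 0 < b → a * b ≡ q + x → a + b ≡ x * q → q ≤ 5
vieta-bound {q = zero} _ _ _ _ = z≤n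
vieta-bound {suc a} {suc b} {suc q} {zero} _ _ _ ()
vieta-bound {suc a} {suc b} {suc q} {suc zero} _ _ product sum = begin
  suc q          ≡⟨ sym (trans sum (+-identityʳ (suc q))) ⟩
  suc a + suc b  ≡⟨ cong suc (+-suc a b) ⟩
  2 + (a + b)    ≤⟨ +-monoʳ-≤ 2 (*≡2⇒+≤3 {a} {b} (shifted-vieta a b q 0 product sum)) ⟩
  5              ∎
  where open ≤-Reasoning
vieta-bound {suc a} {suc b} {suc q} {suc (suc x)} _ _ product sum = s≤s (begin
  q                        ≤⟨ m≤n*m q (suc x) ⟩
  suc x * q                ≤⟨ m≤m+n (suc x * q) (a * b) ⟩
  suc x * q + a * b        ≡⟨ shifted-vieta a b q (suc x) product sum ⟩
  2                        ≤⟨ s≤s (s≤s z≤n) ⟩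
  4                        ∎)
  where open ≤-Reasoning

exchange⇒vieta : ∀ {q a b} → 0 < a → q * (a * b) ≡ q * q + a + b →
                 ∃[ x ] (a * b ≡ q + x × a + b ≡ x * q)
exchange⇒vieta {q} {a} {b} a>0 exchange = x , product , sum
  where
  q<ab : q < a * b
  q<ab = *-cancelˡ-< q q (a * b) (begin-strict
    q * q          <⟨ m<m+n (q * q) a>0 ⟩
    q * q + a      ≤⟨ m≤m+n (q * q + a) b ⟩
    q * q + a + b  ≡⟨ sym exchange ⟩
    q * (a * b)    ∎)
    where open ≤-Reasoning
  x : ℕ
  x = a * b ∸ q
  product : a * b ≡ q + x
  product = sym (m+[n∸m]≡n (<⇒≤ q<ab))
  sum : a + b ≡ x * q
  sum = sym (+-cancelˡ-≡ (q * q) (x * q) (a + b) (begin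
    q * q + x * q   ≡⟨ sym (trans (*-distribˡ-+ q q x) (cong (_+_ (q * q)) (*-comm q x))) ⟩
    q * (q + x)     ≡⟨ cong (q *_) (sym product) ⟩
    q * (a * b)     ≡⟨ exchange ⟩
    q * q + a + b   ≡⟨ +-assoc (q * q) a b ⟩
    q * q + (a + b) ∎))
    where open ≡-Reasoning

exchange-bound : ∀ {q a b} → 0 < a → 0 < b → q * (a * b) ≡ q * q + a + b → q ≤ 5
exchange-bound a>0 b>0 exchange with x , product , sum ← exchange⇒vieta a>0 exchange =
  vieta-bound a>0 b>0 product sum

eliminate-middle : ∀ {a q b p p′} → 0 < q → a * q ≡ 1 + p → q * b ≡ 1 + p′ → p * p′ ≡ 1 + q ^ 3 →
                   q * (a * b) ≡ q * q + a + b
eliminate-middle {a} {q} {b} {p} {p′} q>0 left right middle =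
  *-cancelˡ-≡ _ _ q {{>-nonZero q>0}} (begin
    q * (q * (a * b))         ≡⟨ regroup a q b ⟩
    (a * q) * (q * b)         ≡⟨ cong₂ _*_ left right ⟩
    (1 + p) * (1 + p′)        ≡⟨ expand p p′ ⟩
    p + p′ + (1 + p * p′)     ≡⟨ cong (λ t → p + p′ + suc t) middle ⟩
    p + p′ + (2 + q ^ 3)      ≡⟨ shuffle p p′ q ⟩
    (1 + p) + (1 + p′) + q ^ 3 ≡⟨ cong₂ (λ u v → u + v + q ^ 3) (sym left) (sym right) ⟩
    a * q + q * b + q ^ 3     ≡⟨ factor a q b ⟩
    q * (q * q + a + b)       ∎)
  where
  open ≡-Reasoning
  regroup : ∀ a q b → q * (q * (a * b)) ≡ (a * q) * (q * b)
  regroup = solve-∀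
  expand : ∀ p p′ → (1 + p) * (1 + p′) ≡ p + p′ + (1 + p * p′)
  expand = solve-∀
  shuffle : ∀ p p′ q → p + p′ + (2 + q * (q * (q * 1))) ≡ (1 + p) + (1 + p′) + q * (q * (q * 1))
  shuffle = solve-∀
  factor : ∀ a q b → a * q + q * b + q * (q * (q * 1)) ≡ q * (q * q + a + b)
  factor = solve-∀

unique-cofactorʳ : ∀ {x x′ y y′ c c′} → 0 < x → x ≡ x′ → c ≡ c′ → x * y ≡ c → x′ * y′ ≡ c′ → y ≡ y′
unique-cofactorʳ {x} {y = y} {y′} x>0 refl refl e e′ = *-cancelˡ-≡ y y′ x {{>-nonZero x>0}} (trans e (sym e′))

unique-cofactorˡ : ∀ {x x′ y y′ c c′} → 0 < y → y ≡ y′ → c ≡ c′ → x * y ≡ c → x′ * y′ ≡ c′ → x ≡ x′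
unique-cofactorˡ {x} {x′} {y} y>0 refl refl e e′ = *-cancelʳ-≡ x x′ y {{>-nonZero y>0}} (trans e (sym e′))

sucℤ : ℤ → ℤ
sucℤ m = m +ℤ + 1

ℤ-induction : (A : ℤ → Set) → A (+ 0) → (∀ m → A m → A (sucℤ m)) → (∀ m → A (sucℤ m) → A m) → ∀ m → A m
ℤ-induction A base up down (+ zero)      = base
ℤ-induction A base up down (+ suc n)     =
  subst A (cong +_ (+-comm n 1)) (up (+ n) (ℤ-induction A base up down (+ n)))
ℤ-induction A base up down -[1+ zero ]   = down -[1+ 0 ] base
ℤ-induction A base up down -[1+ suc n ]  = down -[1+ suc n ] (ℤ-induction A base up down -[1+ n ])

P Q : Frieze → ℤ → ℕ
P F = a F zero
Q F = a F (suc zero)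

rhs-vertex₀ : ∀ f m → rhs f zero m ≡ 1 + f (suc zero) m ^ 3
rhs-vertex₀ f m = cong suc (trans (*-identityʳ _) (*-identityˡ _))

rhs-vertex₁ : ∀ f m → rhs f (suc zero) m ≡ 1 + f zero (sucℤ m)
rhs-vertex₁ f m = cong suc (trans (+-identityʳ _) (trans (*-identityʳ _) (*-identityʳ _)))

P-relation : ∀ F m → P F m * P F (sucℤ m) ≡ 1 + Q F m ^ 3
P-relation F m = trans (relation F zero m) (rhs-vertex₀ (a F) m)

Q-relation : ∀ F m → Q F m * Q F (sucℤ m) ≡ 1 + P F (sucℤ m)
Q-relation F m = trans (relation F (suc zero) m) (rhs-vertex₁ (a F) m)

Q-exchange : ∀ F m → Q F (sucℤ m) * (Q F m * Q F (sucℤ (sucℤ m))) ≡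
                     Q F (sucℤ m) * Q F (sucℤ m) + Q F m + Q F (sucℤ (sucℤ m))
Q-exchange F m = eliminate-middle (positive F (suc zero) (sucℤ m))
  (Q-relation F m) (Q-relation F (sucℤ m)) (P-relation F (sucℤ m))

Q≤5 : ∀ F m → Q F (sucℤ m) ≤ 5
Q≤5 F m = exchange-bound (positive F (suc zero) m) (positive F (suc zero) _) (Q-exchange F m)

module _ (F G : Frieze) where

  AgreeAt : ℤ → Set
  AgreeAt m = P F m ≡ P G m × Q F m ≡ Q G m

  agree-suc : ∀ m → AgreeAt m → AgreeAt (sucℤ m)
  agree-suc m (P≡ , Q≡) = P′≡ , Q′≡
    where
    P′≡ : P F (sucℤ m) ≡ P G (sucℤ m)
    P′≡ = unique-cofactorʳ (positive F zero m) P≡ (cong (λ t → 1 + t ^ 3) Q≡)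
            (P-relation F m) (P-relation G m)
    Q′≡ : Q F (sucℤ m) ≡ Q G (sucℤ m)
    Q′≡ = unique-cofactorʳ (positive F (suc zero) m) Q≡ (cong suc P′≡) (Q-relation F m) (Q-relation G m)

  agree-pred : ∀ m → AgreeAt (sucℤ m) → AgreeAt m
  agree-pred m (P′≡ , Q′≡) = P≡ , Q≡
    where
    Q≡ : Q F m ≡ Q G m
    Q≡ = unique-cofactorˡ (positive F (suc zero) (sucℤ m)) Q′≡ (cong suc P′≡)
           (Q-relation F m) (Q-relation G m)
    P≡ : P F m ≡ P G m
    P≡ = unique-cofactorˡ (positive F zero (sucℤ m)) P′≡ (cong (λ t → 1 + t ^ 3) Q≡)
           (P-relation F m) (P-relation G m)

  window-determines : Q F -[1+ 0 ] ≡ Q G -[1+ 0 ] → Q F (+ 0) ≡ Q G (+ 0) → F ≈F G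
  window-determines Q₋₁≡ Q₀≡ = vertexwise
    where
    P₀≡ : P F (+ 0) ≡ P G (+ 0)
    P₀≡ = suc-injective (trans (sym (Q-relation F -[1+ 0 ]))
            (trans (cong₂ _*_ Q₋₁≡ Q₀≡) (Q-relation G -[1+ 0 ])))
    agree : ∀ m → AgreeAt m
    agree = ℤ-induction AgreeAt (P₀≡ , Q₀≡) agree-suc agree-pred
    vertexwise : F ≈F G
    vertexwise zero       m = proj₁ (agree m)
    vertexwise (suc zero) m = proj₂ (agree m)

next previous : Fin 4 → Fin 4
next zero                   = suc zero
next (suc zero)             = suc (suc zero)
next (suc (suc zero))       = suc (suc (suc zero))
next (suc (suc (suc zero))) = zero
previous zero                   = suc (suc (suc zero))
previous (suc zero)             = zero
previous (suc (suc zero))       = suc zero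
previous (suc (suc (suc zero))) = suc (suc zero)

next-previous : ∀ t → next (previous t) ≡ t
next-previous zero                   = refl
next-previous (suc zero)             = refl
next-previous (suc (suc zero))       = refl
next-previous (suc (suc (suc zero))) = refl

phase : ℤ → Fin 4
phase (+ zero)      = zero
phase (+ suc n)     = next (phase (+ n))
phase -[1+ zero ]   = previous zero
phase -[1+ suc n ]  = previous (phase -[1+ n ])

phase-suc : ∀ m → phase (sucℤ m) ≡ next (phase m)
phase-suc (+ n)          = cong (λ k → phase (+ k)) (+-comm n 1)
phase-suc -[1+ zero ]    = refl
phase-suc -[1+ suc n ]   = sym (next-previous (phase -[1+ n ]))

q-table : Vec (Vec ℕ 4) 9
q-table = (1 ∷ 3 ∷ 5 ∷ 2 ∷ []) ∷ (3 ∷ 5 ∷ 2 ∷ 1 ∷ []) ∷ (5 ∷ 2 ∷ 1 ∷ 3 ∷ []) ∷ (2 ∷ 1 ∷ 3 ∷ 5 ∷ [])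
        ∷ (1 ∷ 2 ∷ 5 ∷ 3 ∷ []) ∷ (2 ∷ 5 ∷ 3 ∷ 1 ∷ []) ∷ (5 ∷ 3 ∷ 1 ∷ 2 ∷ []) ∷ (3 ∷ 1 ∷ 2 ∷ 5 ∷ [])
        ∷ (2 ∷ 2 ∷ 2 ∷ 2 ∷ []) ∷ []

q-value p-value : Fin 9 → Fin 4 → ℕ
q-value i t = lookup (lookup q-table i) t
-- Forced by the vertex-1 relation Q(m - 1) Q(m) = 1 + P(m).
p-value i t = q-value i (previous t) * q-value i t ∸ 1

value : Fin 9 → Fin 2 → Fin 4 → ℕ
value i zero       = p-value i
value i (suc zero) = q-value i

value-positive : ∀ i j t → 0 < value i j t
value-positive = from-yes (all? λ i → all? λ j → all? λ t → 0 <? value i j t)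

p-value-relation : ∀ i t → p-value i t * p-value i (next t) ≡ 1 + q-value i t ^ 3
p-value-relation = from-yes (all? λ i → all? λ t →
  p-value i t * p-value i (next t) ≟ 1 + q-value i t ^ 3)

q-value-relation : ∀ i t → q-value i t * q-value i (next t) ≡ 1 + p-value i (next t)
q-value-relation = from-yes (all? λ i → all? λ t →
  q-value i t * q-value i (next t) ≟ 1 + p-value i (next t))

periodic-values : Fin 9 → Fin 2 → ℤ → ℕ
periodic-values i j m = value i j (phase m)

periodic-relation : ∀ i j m →
  periodic-values i j m * periodic-values i j (sucℤ m) ≡ rhs (periodic-values i) j m
periodic-relation i zero m = begin
  p-value i (phase m) * p-value i (phase (sucℤ m)) ≡⟨ cong (λ t → p-value i (phase m) * p-value i t) (phase-suc m) ⟩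
  p-value i (phase m) * p-value i (next (phase m)) ≡⟨ p-value-relation i (phase m) ⟩
  1 + q-value i (phase m) ^ 3                      ≡⟨ sym (rhs-vertex₀ (periodic-values i) m) ⟩
  rhs (periodic-values i) zero m                   ∎
  where open ≡-Reasoning
periodic-relation i (suc zero) m = begin
  q-value i (phase m) * q-value i (phase (sucℤ m)) ≡⟨ cong (λ t → q-value i (phase m) * q-value i t) (phase-suc m) ⟩
  q-value i (phase m) * q-value i (next (phase m)) ≡⟨ q-value-relation i (phase m) ⟩
  1 + p-value i (next (phase m))                   ≡⟨ cong (λ t → 1 + p-value i t) (sym (phase-suc m)) ⟩
  1 + p-value i (phase (sucℤ m))                   ≡⟨ sym (rhs-vertex₁ (periodic-values i) m) ⟩
  rhs (periodic-values i) (suc zero) m             ∎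
  where open ≡-Reasoning

periodic-frieze : Fin 9 → Frieze
periodic-frieze i = record
  { a        = periodic-values i
  ; positive = λ j m → value-positive i j (phase m)
  ; relation = periodic-relation i
  }

window-injective : ∀ i k → Q (periodic-frieze i) -[1+ 0 ] ≡ Q (periodic-frieze k) -[1+ 0 ] →
                   Q (periodic-frieze i) (+ 0) ≡ Q (periodic-frieze k) (+ 0) → i ≡ k
window-injective = from-yes (all? λ i → all? λ k →
  (Q (periodic-frieze i) -[1+ 0 ] ≟ Q (periodic-frieze k) -[1+ 0 ]) →-dec
  (Q (periodic-frieze i) (+ 0) ≟ Q (periodic-frieze k) (+ 0)) →-dec (i ≟ᶠ k))

classify-window : ∀ {a} → a < 6 → ∀ {b} → b < 6 → ∀ {c} → c < 6 → 0 < b → b * (a * c) ≡ b * b + a + c →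
                  ∃[ i ] (a ≡ Q (periodic-frieze i) -[1+ 0 ] × b ≡ Q (periodic-frieze i) (+ 0))
classify-window = from-yes (allUpTo? (λ a → allUpTo? (λ b → allUpTo? (λ c →
  (0 <? b) →-dec (b * (a * c) ≟ b * b + a + c) →-dec
  any? λ i → (a ≟ Q (periodic-frieze i) -[1+ 0 ]) ×-dec (b ≟ Q (periodic-frieze i) (+ 0))) 6) 6) 6)

window-matches-periodic : ∀ F →
  ∃[ i ] (Q F -[1+ 0 ] ≡ Q (periodic-frieze i) -[1+ 0 ] × Q F (+ 0) ≡ Q (periodic-frieze i) (+ 0))
window-matches-periodic F = classify-window (s≤s (Q≤5 F -[1+ 1 ])) (s≤s (Q≤5 F -[1+ 0 ])) (s≤s (Q≤5 F (+ 0)))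
  (positive F (suc zero) (+ 0)) (Q-exchange F -[1+ 0 ])

theorem3p4 : HasExactly 9
theorem3p4 = periodic-frieze , injective , classify
  where
  injective : ∀ i k → periodic-frieze i ≈F periodic-frieze k → i ≡ k
  injective i k same = window-injective i k (same (suc zero) -[1+ 0 ]) (same (suc zero) (+ 0))
  classify : ∀ F → Σ (Fin 9) λ i → F ≈F periodic-frieze i
  classify F = let i , Q₋₁≡ , Q₀≡ = window-matches-periodic F in i , window-determines F (periodic-frieze i) Q₋₁≡ Q₀≡
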